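{- For every container $A\triangleleft P$, define $\mathsf{c}_{A\triangleleft P}:\big(\prod_{a:A}P\,a\big)\to\prod_{t:\mathsf{Tree}(A,P)}\mathsf{Path}_{A,P}(t)$ recursively by $\mathsf{c}_{A\triangleleft P}\,h\,\mathsf{leaf}=\mathsf{stop}$ and $\mathsf{c}_{A\triangleleft P}\,h\,(\mathsf{node}(a,t))=\mathsf{step}\big(h\,a,\ \mathsf{c}_{A\triangleleft P}\,h\,(t\,(h\,a))\big)$. Then the family $\mathsf{c}$ is a natural transformation $\langle\!\langle-\rangle\!\rangle\to\langle\!\langle\mathcal{T}(-)\rangle\!\rangle$ of functors $\mathbf{Cont}^{\mathrm{op}}\to\mathbf{Type}$, and it is the structure map of a right $\mathcal{T}$-comodule with carrier $\langle\!\langle-\rangle\!\rangle$, i.e. $\langle\!\langle\eta_{X}\rangle\!\rangle\circ\mathsf{c}_X=\mathrm{id}$ and $\mathsf{c}_{\mathcal{T}X}\circ\mathsf{c}_X=\langle\!\langle\mu_X\rangle\!\rangle\circ\mathsf{c}_X$ for every container $X$.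
   Context: Work in extensional Martin-Löf type theory with a universe $\mathbf{Type}$. A container $A\triangleleft P$ is a type $A$ with a family $P:A\to\mathbf{Type}$. A container morphism $f\triangleleft g:A\triangleleft P\to B\triangleleft Q$ is $f:A\to B$ with $g:\prod_{\{a:A\}}(Q\,(f\,a)\to P\,a)$; composition $(k\triangleleft l)\circ(f\triangleleft g)=(k\circ f)\triangleleft(\lambda\{a\}.\,g\{a\}\circ l\{f\,a\})$, identities are pairs of identities; this is the category $\mathbf{Cont}$. The cointerpretation functor $\langle\!\langle-\rangle\!\rangle:\mathbf{Cont}^{\mathrm{op}}\to\mathbf{Type}$ is $\langle\!\langle A\triangleleft P\rangle\!\rangle=\prod_{a:A}P\,a$ and, for $f\triangleleft g:A\triangleleft P\to B\triangleleft Q$, $\langle\!\langle f\triangleleft g\rangle\!\rangle:\prod_{b:B}Q\,b\to\prod_{a:A}P\,a$, $\alpha\mapsto\lambda a.\,g\{a\}(\alpha(f\,a))$. Trees: $\mathsf{Tree}(A,P)$ is inductively generated by $\mathsf{leaf}$ and $\mathsf{node}(a,t)$ for $a:A$, $t:P\,a\to\mathsf{Tree}(A,P)$. Paths: $\mathsf{Path}_{A,P}(t)$ is inductively generated by $\mathsf{stop}:\mathsf{Path}_{A,P}(\mathsf{leaf})$ and $\mathsf{step}(p,\pi):\mathsf{Path}_{A,P}(\mathsf{node}(a,t))$ for $p:P\,a$, $\pi:\mathsf{Path}_{A,P}(t\,p)$. The tree monad $(\mathcal{T},\eta,(-)^\dagger)$ on $\mathbf{Cont}$ (Kleisli triple form):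 $\mathcal{T}(A\triangleleft P)=\mathsf{Tree}(A,P)\triangleleft(\lambda t.\,\mathsf{Path}_{A,P}(t))$. Unit $\eta_{A\triangleleft P}$ has shape map $a\mapsto\mathsf{node}(a,\lambda\_.\,\mathsf{leaf})$ and position map $\mathsf{step}(p,\mathsf{stop})\mapsto p$. Grafting: $\mathsf{graft}\,\mathsf{leaf}\,u=u\,\mathsf{stop}$, $\mathsf{graft}\,(\mathsf{node}(a,t))\,u=\mathsf{node}(a,\lambda p.\,\mathsf{graft}\,(t\,p)\,(\lambda\vec p.\,u(\mathsf{step}(p,\vec p))))$ for $u:\mathsf{Path}(t)\to\mathsf{Tree}(A,P)$. Path decomposition $\mathsf{pfst}:\mathsf{Path}(\mathsf{graft}\,t\,u)\to\mathsf{Path}(t)$ and $\mathsf{psnd}:\prod_{\vec p}\mathsf{Path}(u(\mathsf{pfst}\,\vec p))$: for $t=\mathsf{leaf}$, $\mathsf{pfst}\,\vec p=\mathsf{stop}$, $\mathsf{psnd}\,\vec p=\vec p$; for $t=\mathsf{node}(a,t')$, $\mathsf{pfst}(\mathsf{step}(p,\vec p))=\mathsf{step}(p,\mathsf{pfst}\,\vec p)$ and $\mathsf{psnd}(\mathsf{step}(p,\vec p))=\mathsf{psnd}\,\vec p$ (computed with respect to $t'\,p$ and $\lambda\vec q.\,u(\mathsf{step}(p,\vec q))$). For $f\triangleleft g:A\triangleleft P\to\mathcal{T}(B\triangleleft Q)$, the extension $(f\triangleleft g)^\dagger:\mathcal{T}(A\triangleleft P)\to\mathcal{T}(B\triangleleft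 Q)$ has shape map $s$ with $s\,\mathsf{leaf}=\mathsf{leaf}$, $s(\mathsf{node}(a,t))=\mathsf{graft}\,(f\,a)\,(\lambda\vec q.\,s(t(g\{a\}\vec q)))$, and position map $r$ with $r\{\mathsf{leaf}\}\vec q=\mathsf{stop}$, $r\{\mathsf{node}(a,t)\}\vec q=\mathsf{step}(g\{a\}(\mathsf{pfst}\,\vec q),\ r(\mathsf{psnd}\,\vec q))$. The functor action is $\mathcal{T}k=(\eta\circ k)^\dagger$ and the multiplication is $\mu_X=(\mathrm{id}_{\mathcal{T}X})^\dagger$. Naturality of $\mathsf{c}$ means $\langle\!\langle\mathcal{T}k\rangle\!\rangle\circ\mathsf{c}_Y=\mathsf{c}_X\circ\langle\!\langle k\rangle\!\rangle$ for every container morphism $k:X\to Y$. -}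

module Defs where

open import Relation.Binary.PropositionalEquality using (_≡_)

record Cont : Set₁ where
  constructor _◁_
  field
    Sh  : Set
    Pos : Sh → Set
open Cont public

record ContHom (X Y : Cont) : Set where
  constructor _◁ₘ_
  field
    shf : Sh X → Sh Y
    psf : ∀ {a : Sh X} → Pos Y (shf a) → Pos X a
open ContHom public

idC : (X : Cont) → ContHom X X
idC X = (λ a → a) ◁ₘ (λ p → p)

_∘C_ : {X Y Z : Cont} → ContHom Y Z → ContHom X Y → ContHom X Z
(k ◁ₘ l) ∘C (f ◁ₘ g) = (λ a → k (f a)) ◁ₘ (λ {a} q → g {a} (l {f a} q))

⟪_⟫ : Cont → Set
⟪ X ⟫ = (a : Sh X) → Pos X a

⟪_⟫₁ : {X Y : Cont} → ContHom X Y → ⟪ Y ⟫ → ⟪ X ⟫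
⟪ f ◁ₘ g ⟫₁ α = λ a → g {a} (α (f a))

data Tree (A : Set) (P : A → Set) : Set where
  leaf : Tree A P
  node : (a : A) → (P a → Tree A P) → Tree A P

data Path {A : Set} {P : A → Set} : Tree A P → Set where
  stop : Path leaf
  step : ∀ {a : A} {t : P a → Tree A P} (p : P a) → Path (t p) → Path (node a t)

T : Cont → Cont
T (A ◁ P) = Tree A P ◁ Path

η : (X : Cont) → ContHom X (T X)
η (A ◁ P) = (λ a → node a (λ _ → leaf)) ◁ₘ ηpos
  where
  ηpos : ∀ {a : A} → Path {A} {P} (node a (λ _ → leaf)) → P a
  ηpos (step p stop) = p

graft : {A : Set} {P : A → Set} (t : Tree A P) → (Path t → Tree A P) → Tree A P
graft leaf u = u stop
graft (node a t) u = node a (λ p → graft (t p) (λ ps → u (step p ps)))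

pfst : {A : Set} {P : A → Set} (t : Tree A P) (u : Path t → Tree A P) →
       Path (graft t u) → Path t
pfst leaf u ps = stop
pfst (node a t) u (step p ps) = step p (pfst (t p) (λ qs → u (step p qs)) ps)

psnd : {A : Set} {P : A → Set} (t : Tree A P) (u : Path t → Tree A P) →
       (ps : Path (graft t u)) → Path (u (pfst t u ps))
psnd leaf u ps = ps
psnd (node a t) u (step p ps) = psnd (t p) (λ qs → u (step p qs)) ps

module Ext {A : Set} {P : A → Set} {B : Set} {Q : B → Set}
           (f : A → Tree B Q) (g : ∀ {a : A} → Path (f a) → P a) where
  s : Tree A P → Tree B Q
  s leaf = leaf
  s (node a t) = graft (f a) (λ qs → s (t (g qs)))

  r : ∀ {t : Tree A P} → Path (s t) → Path t
  r {leaf} qs = stop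
  r {node a t} qs =
    step (g (pfst (f a) (λ ps → s (t (g ps))) qs))
         (r {t (g (pfst (f a) (λ ps → s (t (g ps))) qs))}
            (psnd (f a) (λ ps → s (t (g ps))) qs))

_† : {X Y : Cont} → ContHom X (T Y) → ContHom (T X) (T Y)
_† {A ◁ P} {B ◁ Q} (f ◁ₘ g) = Ext.s f g ◁ₘ (λ {t} → Ext.r f g {t})

Tmap : {X Y : Cont} → ContHom X Y → ContHom (T X) (T Y)
Tmap {X} {Y} k = (η Y ∘C k) †

μ : (X : Cont) → ContHom (T (T X)) (T X)
μ X = idC (T X) †

c : (X : Cont) → ⟪ X ⟫ → ⟪ T X ⟫
c (A ◁ P) h = go
  where
  go : (t : Tree A P) → Path t
  go leaf = stop
  go (node a t) = step (h a) (go (t (h a)))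

-- The comodule structure map c h follows, through a tree, the branch that h
-- selects at every node.
-- For coassociativity, the branch selected in a grafted tree graft τ u splits
-- (via pfst/psnd) into the branch selected in τ followed by the branch
-- selected in the subtree u grafted at its end; this is exactly how μ
-- reads off positions, so both sides of the law choose the same path.
module Submission where

open import Defs
open import Data.Product using (Σ; _×_; _,_)
open import Function using (id; _∘_)
open import Relation.Binary.PropositionalEquality using (_≡_; refl; cong; sym; module ≡-Reasoning)

c-natural : (X Y : Cont) (k : ContHom X Y) (h : ⟪ Y ⟫) (t : Sh (T X)) →
            ⟪ Tmap k ⟫₁ (c Y h) t ≡ c X (⟪ k ⟫₁ h) t
c-natural X Y k h leaf = refl
c-natural X Y k@(f ◁ₘ g) h (node a t) =
  cong (step (g (h (f a)))) (c-natural X Y k h (t (g (h (f a)))))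

c-counit : (X : Cont) (h : ⟪ X ⟫) (a : Sh X) → ⟪ η X ⟫₁ (c X h) a ≡ h a
c-counit X h a = refl

module _ {A : Set} {P : A → Set} (h : (a : A) → P a) where

  private
    ch : (t : Tree A P) → Path t
    ch = c (A ◁ P) h

  c-graft : (τ : Tree A P) (u : Path τ → Tree A P) →
            _≡_ {A = Σ (Path τ) (λ p → Path (u p))}
              (pfst τ u (ch (graft τ u)) , psnd τ u (ch (graft τ u)))
              (ch τ , ch (u (ch τ)))
  c-graft leaf u = refl
  c-graft (node a τ) u =
    cong (λ { (p , ps) → step (h a) p , ps }) (c-graft (τ (h a)) (λ ps → u (step (h a) ps)))

  c-coassoc : (t : Tree (Tree A P) Path) → c (T (A ◁ P)) ch t ≡ ⟪ μ (A ◁ P) ⟫₁ ch t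
  c-coassoc leaf = refl
  c-coassoc (node τ t) = begin
    step (ch τ) (c (T (A ◁ P)) ch (t (ch τ)))
      ≡⟨ cong (step (ch τ)) (c-coassoc (t (ch τ))) ⟩
    step (ch τ) (Ext.r id id (ch (flatten (t (ch τ)))))
      ≡⟨ cong (λ { (p , ps) → step p (Ext.r id id {t p} ps) }) (sym (c-graft τ (flatten ∘ t))) ⟩
    ⟪ μ (A ◁ P) ⟫₁ ch (node τ t) ∎
    where
    open ≡-Reasoning
    flatten : Tree (Tree A P) Path → Tree A P
    flatten = Ext.s id id

proposition5 :
    ((X Y : Cont) (k : ContHom X Y) (h : ⟪ Y ⟫) (t : Sh (T X)) →
       ⟪ Tmap k ⟫₁ (c Y h) t ≡ c X (⟪ k ⟫₁ h) t)
    ×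
    ((X : Cont) (h : ⟪ X ⟫) (a : Sh X) → ⟪ η X ⟫₁ (c X h) a ≡ h a)
    ×
    ((X : Cont) (h : ⟪ X ⟫) (t : Sh (T (T X))) →
       c (T X) (c X h) t ≡ ⟪ μ X ⟫₁ (c X h) t)
proposition5 = c-natural , c-counit , λ { (A ◁ P) h → c-coassoc h }
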